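{- The sequence $A_n=108^n[z^n]\,{}_2F_1(\tfrac16,\tfrac13;1;z)^3$ satisfies, for all $n\ge 0$, \[ (n+2)^4A_{n+2}-6(36n^4+198n^3+424n^2+417n+158)A_{n+1}+324(n+1)(2n+1)(3n+2)(6n+5)A_n=0, \] with $A_0=1$, $A_1=18$, $A_2=864$.
   Context: ${}_2F_1(a,b;c;z)=\sum_{n\ge0}\frac{(a)_n(b)_n}{(c)_n n!}z^n$ is the Gauss hypergeometric series, and $[z^n]$ denotes the coefficient of $z^n$. -}

module Defs where

open import Data.Nat as ℕ using (ℕ; zero; suc)

open import Data.Integer using (+_)
open import Data.Rational using (ℚ; 0ℚ; 1ℚ; _+_; _*_; _/_; 1/_; ≢-nonZero)
open import Data.Rational.Properties using (_≟_)
open import Data.List using (List; map; upTo; sum; foldr)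
open import Relation.Nullary using (yes; no)

ℕtoℚ : ℕ → ℚ
ℕtoℚ n = (+ n) / 1

-- total inverse on ℚ (1/p for p ≠ 0, and 0 at 0); only ever applied to nonzero values below
inv : ℚ → ℚ
inv p with p ≟ 0ℚ
... | yes _ = 0ℚ
... | no p≢0 = (1/ p) {{≢-nonZero p≢0}}

poch : ℚ → ℕ → ℚ
poch a zero = 1ℚ
poch a (suc n) = poch a n * (a + ℕtoℚ n)

hyp2F1 : ℚ → ℚ → ℚ → ℕ → ℚ
hyp2F1 a b c n = poch a n * poch b n * inv (poch c n * ℕtoℚ (n ℕ.!))

-- formal power series with rational coefficients, as coefficient sequences
Series : Set
Series = ℕ → ℚ

sumℚ : List ℚ → ℚ
sumℚ = foldr _+_ 0ℚ

_⊛_ : Series → Series → Series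
(f ⊛ g) n = sumℚ (map (λ k → f k * g (n ℕ.∸ k)) (upTo (suc n)))

_^ℚ_ : ℚ → ℕ → ℚ
q ^ℚ zero = 1ℚ
q ^ℚ suc n = q * (q ^ℚ n)

F : Series
F = hyp2F1 ((+ 1) / 6) ((+ 1) / 3) 1ℚ

A : ℕ → ℚ
A n = (ℕtoℚ 108 ^ℚ n) * (F ⊛ (F ⊛ F)) n

-- F = 2F1(1/6, 1/3; 1; z) satisfies the hypergeometric equation θ²F = z (θ + 1/6)(θ + 1/3) F, where
-- θ = z d/dz.  With G = θF and V = 1/(1 - z) this becomes θG = zV (G/2 + F/18), and moreover
-- θz = z and θV = zV².  As θ is a derivation, θᵏ(F³) is a polynomial in z, V, F, G that can be
-- computed symbolically, and so is L(F³) for the operator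
--   L = 36θ⁴ - 2z (36θ⁴ + 54θ³ + 46θ² + 19θ + 3) + z² (θ + 1)(2θ + 1)(3θ + 2)(6θ + 5).
-- The ring solver shows that this polynomial is a multiple of 1 + zV - V, hence L(F³) = 0.  The
-- coefficient of z^(n+2) in L(F³) gives a three-term recurrence for [zⁿ] F³, and multiplying it
-- by 324 · 108ⁿ gives the recurrence for Aₙ.

module Submission where

open import Level using (0ℓ)
open import Function using (id; _∘_)
open import Data.Empty using (⊥-elim)
open import Data.Product using (_×_; _,_)
open import Data.Maybe using (just; nothing)
open import Data.Nat as ℕ using (ℕ; zero; suc; _∸_; _!)
import Data.Nat.Coprimality as Coprimality
import Data.Integer as ℤ
import Data.Integer.Properties as ℤ
open import Data.Rational using (ℚ; 0ℚ; 1ℚ; _+_; _*_; _-_; -_; _/_; mkℚ; ↥_; toℚᵘ; ≢-nonZero)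
import Data.Rational.Base as ℚ
open import Data.Rational.Properties
import Data.Rational.Unnormalised as ℚᵘ
import Data.Rational.Unnormalised.Properties as ℚᵘ
open import Data.Rational.Solver
open import Data.Fin using (Fin)
open import Data.Fin.Patterns using (0F; 1F; 2F; 3F)
open import Data.List using (List; []; _∷_)
open import Data.List.Properties using (map-applyUpTo)
open import Data.Vec using (lookup; []; _∷_)
open import Relation.Nullary using (Dec; yes; no)
open import Relation.Binary.Definitions using (WeaklyDecidable)
open import Relation.Binary.PropositionalEquality
open import Algebra.Bundles using (CommutativeRing)
open import Algebra.Structures using (IsCommutativeRing)
import Algebra.Construct.Pointwise ℕ as Pointwise
import Algebra.Consequences.Setoid as Consequences
open import Algebra.Solver.Ring.AlmostCommutativeRing
  using (fromCommutativeRing; _-Raw-AlmostCommutative⟶_; Induced-equivalence)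
import Algebra.Solver.Ring

open import Defs

open +-*-Solver using (solve; _:+_; _:*_; _:-_; _:=_; con)

-- Arithmetic in ℚ

ℕtoℚ≡mkℚ : ∀ n → ℕtoℚ n ≡ mkℚ (ℤ.+ n) 0 (Coprimality.sym (Coprimality.1-coprimeTo n))
ℕtoℚ≡mkℚ n = normalize-coprime (Coprimality.sym (Coprimality.1-coprimeTo n))

toℚᵘ-ℕtoℚ : ∀ n → toℚᵘ (ℕtoℚ n) ≡ ℚᵘ.mkℚᵘ (ℤ.+ n) 0
toℚᵘ-ℕtoℚ n = cong toℚᵘ (ℕtoℚ≡mkℚ n)

ℕtoℚ-+ : ∀ m n → ℕtoℚ (m ℕ.+ n) ≡ ℕtoℚ m + ℕtoℚ n
ℕtoℚ-+ m n = toℚᵘ-injective (begin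
  toℚᵘ (ℕtoℚ (m ℕ.+ n))                     ≡⟨ toℚᵘ-ℕtoℚ (m ℕ.+ n) ⟩
  ℚᵘ.mkℚᵘ (ℤ.+ m ℤ.+ ℤ.+ n) 0               ≈⟨ ℚᵘ.*≡* (cong (ℤ._* ℤ.+ 1) (sym (cong₂ ℤ._+_ (ℤ.*-identityʳ (ℤ.+ m)) (ℤ.*-identityʳ (ℤ.+ n))))) ⟩
  ℚᵘ.mkℚᵘ (ℤ.+ m) 0 ℚᵘ.+ ℚᵘ.mkℚᵘ (ℤ.+ n) 0  ≡⟨ cong₂ ℚᵘ._+_ (toℚᵘ-ℕtoℚ m) (toℚᵘ-ℕtoℚ n) ⟨
  toℚᵘ (ℕtoℚ m) ℚᵘ.+ toℚᵘ (ℕtoℚ n)          ≈⟨ toℚᵘ-homo-+ (ℕtoℚ m) (ℕtoℚ n) ⟨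
  toℚᵘ (ℕtoℚ m + ℕtoℚ n)                    ∎)
  where open ℚᵘ.≃-Reasoning

ℕtoℚ-* : ∀ m n → ℕtoℚ (m ℕ.* n) ≡ ℕtoℚ m * ℕtoℚ n
ℕtoℚ-* m n = toℚᵘ-injective (begin
  toℚᵘ (ℕtoℚ (m ℕ.* n))                     ≡⟨ toℚᵘ-ℕtoℚ (m ℕ.* n) ⟩
  ℚᵘ.mkℚᵘ (ℤ.+ (m ℕ.* n)) 0                 ≡⟨ cong (λ k → ℚᵘ.mkℚᵘ k 0) (ℤ.pos-* m n) ⟩
  ℚᵘ.mkℚᵘ (ℤ.+ m ℤ.* ℤ.+ n) 0               ≡⟨ cong₂ ℚᵘ._*_ (toℚᵘ-ℕtoℚ m) (toℚᵘ-ℕtoℚ n) ⟨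
  toℚᵘ (ℕtoℚ m) ℚᵘ.* toℚᵘ (ℕtoℚ n)          ≈⟨ toℚᵘ-homo-* (ℕtoℚ m) (ℕtoℚ n) ⟨
  toℚᵘ (ℕtoℚ m * ℕtoℚ n)                    ∎)
  where open ℚᵘ.≃-Reasoning

ℕtoℚ-suc : ∀ n → ℕtoℚ (suc n) ≡ 1ℚ + ℕtoℚ n
ℕtoℚ-suc = ℕtoℚ-+ 1

ℕtoℚ-suc≢0 : ∀ n → ℕtoℚ (suc n) ≢ 0ℚ
ℕtoℚ-suc≢0 n eq with trans (sym (cong ↥_ (ℕtoℚ≡mkℚ (suc n)))) (cong ↥_ eq)
... | ()

inv-inverseʳ : ∀ {x} → x ≢ 0ℚ → x * inv x ≡ 1ℚ
inv-inverseʳ {x} x≢0 with x ≟ 0ℚ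
... | yes x≡0 = ⊥-elim (x≢0 x≡0)
... | no x≢0′ = *-inverseʳ x {{≢-nonZero x≢0′}}

*-≢0 : ∀ {x y} → x ≢ 0ℚ → y ≢ 0ℚ → x * y ≢ 0ℚ
*-≢0 {x} {y} x≢0 y≢0 xy≡0 = y≢0 (begin
  y                    ≡⟨ *-identityˡ y ⟨
  1ℚ * y               ≡⟨ cong (_* y) (inv-inverseʳ x≢0) ⟨
  (x * inv x) * y      ≡⟨ solve 3 (λ x x⁻¹ y → (x :* x⁻¹) :* y := x⁻¹ :* (x :* y)) refl x (inv x) y ⟩
  inv x * (x * y)      ≡⟨ cong (inv x *_) xy≡0 ⟩
  inv x * 0ℚ           ≡⟨ *-zeroʳ (inv x) ⟩
  0ℚ                   ∎)
  where open ≡-Reasoning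

inv-0 : ∀ {x} → x ≡ 0ℚ → inv x ≡ 0ℚ
inv-0 refl = refl

inv-* : ∀ x y → inv (x * y) ≡ inv x * inv y
inv-* x y = cases (x ≟ 0ℚ) (y ≟ 0ℚ)
  where
  open ≡-Reasoning
  cases : Dec (x ≡ 0ℚ) → Dec (y ≡ 0ℚ) → inv (x * y) ≡ inv x * inv y
  cases (yes x≡0) _ = begin
    inv (x * y)    ≡⟨ inv-0 (trans (cong (_* y) x≡0) (*-zeroˡ y)) ⟩
    0ℚ             ≡⟨ *-zeroˡ (inv y) ⟨
    0ℚ * inv y     ≡⟨ cong (_* inv y) (inv-0 x≡0) ⟨
    inv x * inv y  ∎
  cases (no _) (yes y≡0) = begin
    inv (x * y)    ≡⟨ inv-0 (trans (cong (x *_) y≡0) (*-zeroʳ x)) ⟩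
    0ℚ             ≡⟨ *-zeroʳ (inv x) ⟨
    inv x * 0ℚ     ≡⟨ cong (inv x *_) (inv-0 y≡0) ⟨
    inv x * inv y  ∎
  cases (no x≢0) (no y≢0) = begin
    inv (x * y)                                ≡⟨ *-identityʳ (inv (x * y)) ⟨
    inv (x * y) * 1ℚ                           ≡⟨ cong (inv (x * y) *_) (cong₂ _*_ (inv-inverseʳ x≢0) (inv-inverseʳ y≢0)) ⟨
    inv (x * y) * ((x * inv x) * (y * inv y))  ≡⟨ solve 5 (λ i x x⁻¹ y y⁻¹ → i :* ((x :* x⁻¹) :* (y :* y⁻¹)) := ((x :* y) :* i) :* (x⁻¹ :* y⁻¹)) refl (inv (x * y)) x (inv x) y (inv y) ⟩
    ((x * y) * inv (x * y)) * (inv x * inv y)  ≡⟨ cong (_* (inv x * inv y)) (inv-inverseʳ (*-≢0 x≢0 y≢0)) ⟩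
    1ℚ * (inv x * inv y)                       ≡⟨ *-identityˡ (inv x * inv y) ⟩
    inv x * inv y                              ∎

hyp2F1-recurrence : ∀ a b c n → c + ℕtoℚ n ≢ 0ℚ →
  ℕtoℚ (suc n) * (c + ℕtoℚ n) * hyp2F1 a b c (suc n) ≡ (a + ℕtoℚ n) * (b + ℕtoℚ n) * hyp2F1 a b c n
hyp2F1-recurrence a b c n c+n≢0 = begin
  S * (c + N) * (Pa * (a + N) * (Pb * (b + N)) * inv (Pc * (c + N) * ℕtoℚ (suc n ℕ.* n !)))
    ≡⟨ cong (λ d → S * (c + N) * (Pa * (a + N) * (Pb * (b + N)) * inv d)) denominator ⟩
  S * (c + N) * (Pa * (a + N) * (Pb * (b + N)) * inv (D * K))
    ≡⟨ cong (λ i → S * (c + N) * (Pa * (a + N) * (Pb * (b + N)) * i)) (inv-* D K) ⟩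
  S * (c + N) * (Pa * (a + N) * (Pb * (b + N)) * (inv D * inv K))
    ≡⟨ solve 9 (λ s c n a b pa pb d⁻¹ k⁻¹ → s :* (c :+ n) :* (pa :* (a :+ n) :* (pb :* (b :+ n)) :* (d⁻¹ :* k⁻¹))
                 := ((c :+ n) :* s) :* k⁻¹ :* ((a :+ n) :* (b :+ n) :* (pa :* pb :* d⁻¹))) refl S c N a b Pa Pb (inv D) (inv K) ⟩
  K * inv K * ((a + N) * (b + N) * hyp2F1 a b c n)
    ≡⟨ cong (_* ((a + N) * (b + N) * hyp2F1 a b c n)) (inv-inverseʳ (*-≢0 c+n≢0 (ℕtoℚ-suc≢0 n))) ⟩
  1ℚ * ((a + N) * (b + N) * hyp2F1 a b c n)
    ≡⟨ *-identityˡ _ ⟩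
  (a + N) * (b + N) * hyp2F1 a b c n ∎
  where
  open ≡-Reasoning
  N S Pa Pb Pc D K : ℚ
  N  = ℕtoℚ n
  S  = ℕtoℚ (suc n)
  Pa = poch a n
  Pb = poch b n
  Pc = poch c n
  D  = Pc * ℕtoℚ (n !)
  K  = (c + N) * S
  denominator : Pc * (c + N) * ℕtoℚ (suc n ℕ.* n !) ≡ D * K
  denominator = begin
    Pc * (c + N) * ℕtoℚ (suc n ℕ.* n !)  ≡⟨ cong (Pc * (c + N) *_) (ℕtoℚ-* (suc n) (n !)) ⟩
    Pc * (c + N) * (S * ℕtoℚ (n !))      ≡⟨ solve 4 (λ p c s f → p :* c :* (s :* f) := p :* f :* (c :* s)) refl Pc (c + N) S (ℕtoℚ (n !)) ⟩
    D * K                                ∎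

-- Formal power series

infixl 6 _⊕_
infixr 7 _∙_

_⊕_ : Series → Series → Series
(f ⊕ g) n = f n + g n

⊖_ : Series → Series
(⊖ f) n = - f n

_∙_ : ℚ → Series → Series
(c ∙ f) n = c * f n

0S : Series
0S _ = 0ℚ

constant : ℚ → Series
constant c zero    = c
constant c (suc _) = 0ℚ

shift : Series → Series
shift f n = f (suc n)

⊛-zero : ∀ f g → (f ⊛ g) 0 ≡ f 0 * g 0
⊛-zero f g = +-identityʳ (f 0 * g 0)

⊛-suc : ∀ f g n → (f ⊛ g) (suc n) ≡ f 0 * g (suc n) + (shift f ⊛ g) n
⊛-suc f g n = cong (λ xs → f 0 * g (suc n) + sumℚ xs)
  (trans (map-applyUpTo suc term (suc n)) (sym (map-applyUpTo id (term ∘ suc) (suc n))))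
  where
  term : ℕ → ℚ
  term k = f k * g (suc n ∸ k)

⊛-cong : ∀ {f f′ g g′} → f ≗ f′ → g ≗ g′ → f ⊛ g ≗ f′ ⊛ g′
⊛-cong f≗f′ g≗g′ zero = cong₂ (λ a b → a * b + 0ℚ) (f≗f′ 0) (g≗g′ 0)
⊛-cong {f} {f′} {g} {g′} f≗f′ g≗g′ (suc n) = begin
  (f ⊛ g) (suc n)                      ≡⟨ ⊛-suc f g n ⟩
  f 0 * g (suc n) + (shift f ⊛ g) n    ≡⟨ cong₂ _+_ (cong₂ _*_ (f≗f′ 0) (g≗g′ (suc n))) (⊛-cong (f≗f′ ∘ suc) g≗g′ n) ⟩
  f′ 0 * g′ (suc n) + (shift f′ ⊛ g′) n ≡⟨ ⊛-suc f′ g′ n ⟨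
  (f′ ⊛ g′) (suc n)                    ∎
  where open ≡-Reasoning

⊛-congˡ : ∀ {f f′} g → f ≗ f′ → f ⊛ g ≗ f′ ⊛ g
⊛-congˡ g f≗f′ = ⊛-cong f≗f′ (λ _ → refl)

⊛-congʳ : ∀ f {g g′} → g ≗ g′ → f ⊛ g ≗ f ⊛ g′
⊛-congʳ f = ⊛-cong {f} (λ _ → refl)

⊛-zeroˡ : ∀ f → 0S ⊛ f ≗ 0S
⊛-zeroˡ f zero    = trans (⊛-zero 0S f) (*-zeroˡ (f 0))
⊛-zeroˡ f (suc n) = trans (⊛-suc 0S f n) (cong₂ _+_ (*-zeroˡ (f (suc n))) (⊛-zeroˡ f n))

constant-⊛ : ∀ c f → constant c ⊛ f ≗ c ∙ f
constant-⊛ c f zero    = ⊛-zero (constant c) f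
constant-⊛ c f (suc n) = begin
  (constant c ⊛ f) (suc n)   ≡⟨ ⊛-suc (constant c) f n ⟩
  c * f (suc n) + (0S ⊛ f) n ≡⟨ cong (c * f (suc n) +_) (⊛-zeroˡ f n) ⟩
  c * f (suc n) + 0ℚ         ≡⟨ +-identityʳ (c * f (suc n)) ⟩
  c * f (suc n)              ∎
  where open ≡-Reasoning

∙-⊛ : ∀ c f g → (c ∙ f) ⊛ g ≗ c ∙ (f ⊛ g)
∙-⊛ c f g zero    = trans (⊛-zero (c ∙ f) g) (trans (*-assoc c (f 0) (g 0)) (cong (c *_) (sym (⊛-zero f g))))
∙-⊛ c f g (suc n) = begin
  ((c ∙ f) ⊛ g) (suc n)                      ≡⟨ ⊛-suc (c ∙ f) g n ⟩
  c * f 0 * g (suc n) + ((c ∙ shift f) ⊛ g) n ≡⟨ cong (c * f 0 * g (suc n) +_) (∙-⊛ c (shift f) g n) ⟩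
  c * f 0 * g (suc n) + c * (shift f ⊛ g) n   ≡⟨ solve 4 (λ c a b d → c :* a :* b :+ c :* d := c :* (a :* b :+ d)) refl c (f 0) (g (suc n)) ((shift f ⊛ g) n) ⟩
  c * (f 0 * g (suc n) + (shift f ⊛ g) n)     ≡⟨ cong (c *_) (⊛-suc f g n) ⟨
  c * (f ⊛ g) (suc n)                        ∎
  where open ≡-Reasoning

⊛-distribʳ : ∀ h f g → (f ⊕ g) ⊛ h ≗ f ⊛ h ⊕ g ⊛ h
⊛-distribʳ h f g zero = begin
  ((f ⊕ g) ⊛ h) 0           ≡⟨ ⊛-zero (f ⊕ g) h ⟩
  (f 0 + g 0) * h 0         ≡⟨ *-distribʳ-+ (h 0) (f 0) (g 0) ⟩
  f 0 * h 0 + g 0 * h 0     ≡⟨ cong₂ _+_ (⊛-zero f h) (⊛-zero g h) ⟨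
  (f ⊛ h) 0 + (g ⊛ h) 0     ∎
  where open ≡-Reasoning
⊛-distribʳ h f g (suc n) = begin
  ((f ⊕ g) ⊛ h) (suc n)
    ≡⟨ ⊛-suc (f ⊕ g) h n ⟩
  (f 0 + g 0) * h (suc n) + ((shift f ⊕ shift g) ⊛ h) n
    ≡⟨ cong ((f 0 + g 0) * h (suc n) +_) (⊛-distribʳ h (shift f) (shift g) n) ⟩
  (f 0 + g 0) * h (suc n) + ((shift f ⊛ h) n + (shift g ⊛ h) n)
    ≡⟨ solve 5 (λ a b c x y → (a :+ b) :* c :+ (x :+ y) := (a :* c :+ x) :+ (b :* c :+ y)) refl (f 0) (g 0) (h (suc n)) ((shift f ⊛ h) n) ((shift g ⊛ h) n) ⟩
  (f 0 * h (suc n) + (shift f ⊛ h) n) + (g 0 * h (suc n) + (shift g ⊛ h) n)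
    ≡⟨ cong₂ _+_ (⊛-suc f h n) (⊛-suc g h n) ⟨
  (f ⊛ h) (suc n) + (g ⊛ h) (suc n) ∎
  where open ≡-Reasoning

⊛-comm : ∀ f g → f ⊛ g ≗ g ⊛ f
⊛-comm f g zero = trans (⊛-zero f g) (trans (*-comm (f 0) (g 0)) (sym (⊛-zero g f)))
⊛-comm f g (suc zero) = begin
  (f ⊛ g) 1                          ≡⟨ ⊛-suc f g 0 ⟩
  f 0 * g 1 + (shift f ⊛ g) 0        ≡⟨ cong (f 0 * g 1 +_) (⊛-zero (shift f) g) ⟩
  f 0 * g 1 + f 1 * g 0              ≡⟨ solve 4 (λ a b c d → a :* d :+ b :* c := c :* b :+ d :* a) refl (f 0) (f 1) (g 0) (g 1) ⟩
  g 0 * f 1 + g 1 * f 0              ≡⟨ cong (g 0 * f 1 +_) (⊛-zero (shift g) f) ⟨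
  g 0 * f 1 + (shift g ⊛ f) 0        ≡⟨ ⊛-suc g f 0 ⟨
  (g ⊛ f) 1                          ∎
  where open ≡-Reasoning
⊛-comm f g (suc (suc n)) = begin
  (f ⊛ g) (2+n)
    ≡⟨ ⊛-suc f g (suc n) ⟩
  f 0 * g (2+n) + (shift f ⊛ g) (suc n)
    ≡⟨ cong (f 0 * g (2+n) +_) (trans (⊛-comm (shift f) g (suc n)) (⊛-suc g (shift f) n)) ⟩
  f 0 * g (2+n) + (g 0 * f (2+n) + (shift g ⊛ shift f) n)
    ≡⟨ cong (λ x → f 0 * g (2+n) + (g 0 * f (2+n) + x)) (⊛-comm (shift g) (shift f) n) ⟩
  f 0 * g (2+n) + (g 0 * f (2+n) + (shift f ⊛ shift g) n)
    ≡⟨ solve 5 (λ a b c d x → a :* b :+ (c :* d :+ x) := c :* d :+ (a :* b :+ x)) refl (f 0) (g (2+n)) (g 0) (f (2+n)) ((shift f ⊛ shift g) n) ⟩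
  g 0 * f (2+n) + (f 0 * g (2+n) + (shift f ⊛ shift g) n)
    ≡⟨ cong (g 0 * f (2+n) +_) (trans (⊛-comm (shift g) f (suc n)) (⊛-suc f (shift g) n)) ⟨
  g 0 * f (2+n) + (shift g ⊛ f) (suc n)
    ≡⟨ ⊛-suc g f (suc n) ⟨
  (g ⊛ f) (2+n) ∎
  where
  open ≡-Reasoning
  2+n : ℕ
  2+n = suc (suc n)

⊛-assoc : ∀ f g h → (f ⊛ g) ⊛ h ≗ f ⊛ (g ⊛ h)
⊛-assoc f g h zero = begin
  ((f ⊛ g) ⊛ h) 0       ≡⟨ trans (⊛-zero (f ⊛ g) h) (cong (_* h 0) (⊛-zero f g)) ⟩
  f 0 * g 0 * h 0       ≡⟨ *-assoc (f 0) (g 0) (h 0) ⟩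
  f 0 * (g 0 * h 0)     ≡⟨ trans (⊛-zero f (g ⊛ h)) (cong (f 0 *_) (⊛-zero g h)) ⟨
  (f ⊛ (g ⊛ h)) 0       ∎
  where open ≡-Reasoning
⊛-assoc f g h (suc n) = begin
  ((f ⊛ g) ⊛ h) (suc n)
    ≡⟨ ⊛-suc (f ⊛ g) h n ⟩
  (f ⊛ g) 0 * h (suc n) + (shift (f ⊛ g) ⊛ h) n
    ≡⟨ cong₂ (λ a b → a * h (suc n) + b) (⊛-zero f g) (⊛-congˡ h (⊛-suc f g) n) ⟩
  f 0 * g 0 * h (suc n) + ((f 0 ∙ shift g ⊕ shift f ⊛ g) ⊛ h) n
    ≡⟨ cong (f 0 * g 0 * h (suc n) +_) (⊛-distribʳ h (f 0 ∙ shift g) (shift f ⊛ g) n) ⟩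
  f 0 * g 0 * h (suc n) + (((f 0 ∙ shift g) ⊛ h) n + ((shift f ⊛ g) ⊛ h) n)
    ≡⟨ cong₂ (λ a b → f 0 * g 0 * h (suc n) + (a + b)) (∙-⊛ (f 0) (shift g) h n) (⊛-assoc (shift f) g h n) ⟩
  f 0 * g 0 * h (suc n) + (f 0 * (shift g ⊛ h) n + (shift f ⊛ (g ⊛ h)) n)
    ≡⟨ solve 5 (λ a b c d e → a :* b :* c :+ (a :* d :+ e) := a :* (b :* c :+ d) :+ e) refl (f 0) (g 0) (h (suc n)) ((shift g ⊛ h) n) ((shift f ⊛ (g ⊛ h)) n) ⟩
  f 0 * (g 0 * h (suc n) + (shift g ⊛ h) n) + (shift f ⊛ (g ⊛ h)) n
    ≡⟨ cong (λ a → f 0 * a + (shift f ⊛ (g ⊛ h)) n) (⊛-suc g h n) ⟨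
  f 0 * (g ⊛ h) (suc n) + (shift f ⊛ (g ⊛ h)) n
    ≡⟨ ⊛-suc f (g ⊛ h) n ⟨
  (f ⊛ (g ⊛ h)) (suc n) ∎
  where open ≡-Reasoning

⊛-identityˡ : ∀ f → constant 1ℚ ⊛ f ≗ f
⊛-identityˡ f n = trans (constant-⊛ 1ℚ f n) (*-identityˡ (f n))

series-isCommutativeRing : IsCommutativeRing _≗_ _⊕_ _⊛_ ⊖_ 0S (constant 1ℚ)
series-isCommutativeRing = record
  { isRing = record
    { +-isAbelianGroup = Pointwise.isAbelianGroup +-0-isAbelianGroup
    ; *-cong           = ⊛-cong
    ; *-assoc          = ⊛-assoc
    ; *-identity       = comm∧idˡ⇒id ⊛-comm ⊛-identityˡ
    ; distrib          = comm∧distrʳ⇒distr ⊕-cong ⊛-comm ⊛-distribʳ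
    }
  ; *-comm = ⊛-comm
  }
  where
  open Consequences (ℕ →-setoid ℚ)
  ⊕-cong : ∀ {f f′ g g′} → f ≗ f′ → g ≗ g′ → f ⊕ g ≗ f′ ⊕ g′
  ⊕-cong f≗f′ g≗g′ n = cong₂ _+_ (f≗f′ n) (g≗g′ n)

series-commutativeRing : CommutativeRing 0ℓ 0ℓ
series-commutativeRing = record { isCommutativeRing = series-isCommutativeRing }

constant-homomorphism : ℚ.+-*-rawRing -Raw-AlmostCommutative⟶ fromCommutativeRing series-commutativeRing
constant-homomorphism = record
  { ⟦_⟧    = constant
  ; +-homo = λ a b → λ { zero → refl ; (suc _) → refl }
  ; *-homo = λ a b n → sym (trans (constant-⊛ a (constant b) n) (scaled a b n))
  ; -‿homo = λ a → λ { zero → refl ; (suc _) → refl }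
  ; 0-homo = λ { zero → refl ; (suc _) → refl }
  ; 1-homo = λ _ → refl
  }
  where
  scaled : ∀ a b n → a * constant b n ≡ constant (a * b) n
  scaled a b zero    = refl
  scaled a b (suc _) = *-zeroʳ a

constant-≟ : WeaklyDecidable (Induced-equivalence constant-homomorphism)
constant-≟ a b with a ≟ b
... | yes a≡b = just (λ n → cong (λ c → constant c n) a≡b)
... | no _    = nothing

module SeriesSolver = Algebra.Solver.Ring ℚ.+-*-rawRing (fromCommutativeRing series-commutativeRing) constant-homomorphism constant-≟

-- The Euler operator θ = z d/dz

θ : Series → Series
θ f n = ℕtoℚ n * f n

θ-cong : ∀ {f g} → f ≗ g → θ f ≗ θ g
θ-cong f≗g n = cong (ℕtoℚ n *_) (f≗g n)

θ-⊕ : ∀ f g → θ (f ⊕ g) ≗ θ f ⊕ θ g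
θ-⊕ f g n = *-distribˡ-+ (ℕtoℚ n) (f n) (g n)

θ-⊖ : ∀ f → θ (⊖ f) ≗ ⊖ θ f
θ-⊖ f n = sym (neg-distribʳ-* (ℕtoℚ n) (f n))

θ-constant : ∀ c → θ (constant c) ≗ constant 0ℚ
θ-constant c zero    = *-zeroˡ c
θ-constant c (suc n) = *-zeroʳ (ℕtoℚ (suc n))

shift-θ : ∀ f → shift (θ f) ≗ θ (shift f) ⊕ shift f
shift-θ f n = begin
  ℕtoℚ (suc n) * f (suc n)           ≡⟨ cong (_* f (suc n)) (ℕtoℚ-suc n) ⟩
  (1ℚ + ℕtoℚ n) * f (suc n)          ≡⟨ solve 2 (λ n f → (con 1ℚ :+ n) :* f := n :* f :+ f) refl (ℕtoℚ n) (f (suc n)) ⟩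
  ℕtoℚ n * f (suc n) + f (suc n)     ∎
  where open ≡-Reasoning

θ-⊛ : ∀ f g → θ (f ⊛ g) ≗ θ f ⊛ g ⊕ f ⊛ θ g
θ-⊛ f g zero =
  solve 2 (λ a b → con 0ℚ :* (a :* b :+ con 0ℚ) := con 0ℚ :* a :* b :+ con 0ℚ :+ (a :* (con 0ℚ :* b) :+ con 0ℚ)) refl (f 0) (g 0)
θ-⊛ f g (suc n) = begin
  S * (f ⊛ g) (suc n)
    ≡⟨ cong₂ _*_ (ℕtoℚ-suc n) (⊛-suc f g n) ⟩
  (1ℚ + N) * (f 0 * g₁ + P)
    ≡⟨ solve 4 (λ n a b p → (con 1ℚ :+ n) :* (a :* b :+ p) := con 0ℚ :* a :* b :+ p :+ a :* ((con 1ℚ :+ n) :* b) :+ n :* p) refl N (f 0) g₁ P ⟩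
  0ℚ * f 0 * g₁ + P + f 0 * ((1ℚ + N) * g₁) + N * P
    ≡⟨ cong₂ (λ s t → 0ℚ * f 0 * g₁ + P + f 0 * (s * g₁) + t) (sym (ℕtoℚ-suc n)) (θ-⊛ (shift f) g n) ⟩
  0ℚ * f 0 * g₁ + P + f 0 * (S * g₁) + (Q + R)
    ≡⟨ solve 5 (λ a p b q r → a :+ p :+ b :+ (q :+ r) := a :+ (q :+ p) :+ (b :+ r)) refl (0ℚ * f 0 * g₁) P (f 0 * (S * g₁)) Q R ⟩
  0ℚ * f 0 * g₁ + (Q + P) + (f 0 * (S * g₁) + R)
    ≡⟨ cong₂ _+_ θf⊛g (⊛-suc f (θ g) n) ⟨
  (θ f ⊛ g) (suc n) + (f ⊛ θ g) (suc n)
    ∎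
  where
  open ≡-Reasoning
  N S g₁ P Q R : ℚ
  N  = ℕtoℚ n
  S  = ℕtoℚ (suc n)
  g₁ = g (suc n)
  P  = (shift f ⊛ g) n
  Q  = (θ (shift f) ⊛ g) n
  R  = (shift f ⊛ θ g) n
  θf⊛g : (θ f ⊛ g) (suc n) ≡ 0ℚ * f 0 * g₁ + (Q + P)
  θf⊛g = trans (⊛-suc (θ f) g n)
    (cong (0ℚ * f 0 * g₁ +_) (trans (⊛-congˡ g (shift-θ f) n) (⊛-distribʳ g (θ (shift f)) (shift f) n)))

polyθ : List ℚ → Series → Series
polyθ []       f = 0S
polyθ (c ∷ cs) f = c ∙ f ⊕ polyθ cs (θ f)

evalPoly : List ℚ → ℚ → ℚ
evalPoly []       x = 0ℚ
evalPoly (c ∷ cs) x = c + x * evalPoly cs x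

polyθ-coeff : ∀ cs f n → polyθ cs f n ≡ evalPoly cs (ℕtoℚ n) * f n
polyθ-coeff []       f n = sym (*-zeroˡ (f n))
polyθ-coeff (c ∷ cs) f n = begin
  c * f n + polyθ cs (θ f) n        ≡⟨ cong (c * f n +_) (polyθ-coeff cs (θ f) n) ⟩
  c * f n + e * (N * f n)           ≡⟨ solve 4 (λ c e n f → c :* f :+ e :* (n :* f) := (c :+ n :* e) :* f) refl c e N (f n) ⟩
  (c + N * e) * f n                 ∎
  where
  open ≡-Reasoning
  N e : ℚ
  N = ℕtoℚ n
  e = evalPoly cs N

X : Series
X (suc zero) = 1ℚ
X _          = 0ℚ

geometric : Series
geometric _ = 1ℚ

X⊛-zero : ∀ f → (X ⊛ f) 0 ≡ 0ℚ
X⊛-zero f = trans (⊛-zero X f) (*-zeroˡ (f 0))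

X⊛-suc : ∀ f n → (X ⊛ f) (suc n) ≡ f n
X⊛-suc f n = begin
  (X ⊛ f) (suc n)                 ≡⟨ ⊛-suc X f n ⟩
  0ℚ * f (suc n) + (shift X ⊛ f) n ≡⟨ cong₂ _+_ (*-zeroˡ (f (suc n))) (⊛-congˡ f shift-X n) ⟩
  0ℚ + (constant 1ℚ ⊛ f) n         ≡⟨ +-identityˡ _ ⟩
  (constant 1ℚ ⊛ f) n              ≡⟨ ⊛-identityˡ f n ⟩
  f n                              ∎
  where
  open ≡-Reasoning
  shift-X : shift X ≗ constant 1ℚ
  shift-X zero    = refl
  shift-X (suc _) = refl

θ-X : θ X ≗ X
θ-X zero          = refl
θ-X (suc zero)    = refl
θ-X (suc (suc n)) = *-zeroʳ (ℕtoℚ (suc (suc n)))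

geometric-unfold : constant 1ℚ ⊕ X ⊛ geometric ≗ geometric
geometric-unfold zero    = cong (1ℚ +_) (X⊛-zero geometric)
geometric-unfold (suc n) = cong (0ℚ +_) (X⊛-suc geometric n)

partial-sums : ∀ {g} h → g 0 ≡ 0ℚ → (∀ n → g (suc n) ≡ g n + h n) → g ≗ X ⊛ (geometric ⊛ h)
partial-sums {g} h g₀≡0 Δg≡h zero    = trans g₀≡0 (sym (X⊛-zero (geometric ⊛ h)))
partial-sums {g} h g₀≡0 Δg≡h (suc n) = trans (sums n) (sym (X⊛-suc (geometric ⊛ h) n))
  where
  sums : ∀ n → g (suc n) ≡ (geometric ⊛ h) n
  sums zero = begin
    g 1              ≡⟨ Δg≡h 0 ⟩
    g 0 + h 0        ≡⟨ cong (_+ h 0) g₀≡0 ⟩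
    0ℚ + h 0         ≡⟨ +-identityˡ (h 0) ⟩
    h 0              ≡⟨ *-identityˡ (h 0) ⟨
    1ℚ * h 0         ≡⟨ ⊛-zero geometric h ⟨
    (geometric ⊛ h) 0 ∎
    where open ≡-Reasoning
  sums (suc n) = begin
    g (suc (suc n))                       ≡⟨ Δg≡h (suc n) ⟩
    g (suc n) + h (suc n)                 ≡⟨ cong₂ _+_ (sums n) (sym (*-identityˡ (h (suc n)))) ⟩
    (geometric ⊛ h) n + 1ℚ * h (suc n)    ≡⟨ +-comm ((geometric ⊛ h) n) (1ℚ * h (suc n)) ⟩
    1ℚ * h (suc n) + (geometric ⊛ h) n    ≡⟨ ⊛-suc geometric h n ⟨
    (geometric ⊛ h) (suc n)               ∎
    where open ≡-Reasoning

θ-geometric : θ geometric ≗ X ⊛ (geometric ⊛ geometric)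
θ-geometric = partial-sums geometric (*-zeroˡ 1ℚ) (λ n → begin
  ℕtoℚ (suc n) * 1ℚ          ≡⟨ cong (_* 1ℚ) (ℕtoℚ-suc n) ⟩
  (1ℚ + ℕtoℚ n) * 1ℚ         ≡⟨ solve 1 (λ n → (con 1ℚ :+ n) :* con 1ℚ := n :* con 1ℚ :+ con 1ℚ) refl (ℕtoℚ n) ⟩
  ℕtoℚ n * 1ℚ + 1ℚ           ∎)
  where open ≡-Reasoning

θOperator : List ℚ → List ℚ → List ℚ → Series → Series
θOperator p₀ p₁ p₂ f = polyθ p₀ f ⊕ X ⊛ polyθ p₁ f ⊕ X ⊛ (X ⊛ polyθ p₂ f)

θOperator-coeff : ∀ p₀ p₁ p₂ f n → θOperator p₀ p₁ p₂ f (suc (suc n)) ≡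
  evalPoly p₀ (ℕtoℚ (suc (suc n))) * f (suc (suc n)) + evalPoly p₁ (ℕtoℚ (suc n)) * f (suc n) + evalPoly p₂ (ℕtoℚ n) * f n
θOperator-coeff p₀ p₁ p₂ f n = cong₂ _+_
  (cong₂ _+_ (polyθ-coeff p₀ f (suc (suc n))) (trans (X⊛-suc (polyθ p₁ f) (suc n)) (polyθ-coeff p₁ f (suc n))))
  (trans (X⊛-suc (X ⊛ polyθ p₂ f) (suc n)) (trans (X⊛-suc (polyθ p₂ f) n) (polyθ-coeff p₂ f n)))

hypergeometric-equation : ∀ a b → let f = hyp2F1 a b 1ℚ in
  θ (θ f) ≗ X ⊛ (geometric ⊛ ((a + b) ∙ θ f ⊕ (a * b) ∙ f))
hypergeometric-equation a b = partial-sums _ (*-zeroˡ (0ℚ * f 0)) step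
  where
  open ≡-Reasoning
  f : Series
  f = hyp2F1 a b 1ℚ
  step : ∀ n → θ (θ f) (suc n) ≡ θ (θ f) n + ((a + b) ∙ θ f ⊕ (a * b) ∙ f) n
  step n = begin
    S * (S * f (suc n))         ≡⟨ cong (λ s → S * (s * f (suc n))) (ℕtoℚ-suc n) ⟩
    S * ((1ℚ + N) * f (suc n))  ≡⟨ *-assoc S (1ℚ + N) (f (suc n)) ⟨
    S * (1ℚ + N) * f (suc n)    ≡⟨ hyp2F1-recurrence a b 1ℚ n (λ 1+n≡0 → ℕtoℚ-suc≢0 n (trans (ℕtoℚ-suc n) 1+n≡0)) ⟩
    (a + N) * (b + N) * f n     ≡⟨ solve 4 (λ a b n f → (a :+ n) :* (b :+ n) :* f := n :* (n :* f) :+ ((a :+ b) :* (n :* f) :+ (a :* b) :* f)) refl a b N (f n) ⟩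
    N * (N * f n) + ((a + b) * (N * f n) + (a * b) * f n) ∎
    where
    N S : ℚ
    N = ℕtoℚ n
    S = ℕtoℚ (suc n)

-- Symbolic θ-derivatives of polynomial expressions

open SeriesSolver using (Polynomial; op; [+]; [*]; var; _:^_; :-_; Env; ⟦_⟧)
  renaming (con to con′; _:+_ to infixl 6 _⊕′_; _:*_ to infixl 7 _⊛′_)

module _ {m : ℕ} (δ : Fin m → Polynomial m) where

  derivePow : Polynomial m → Polynomial m → ℕ → Polynomial m
  derivePow p dp zero    = con′ 0ℚ
  derivePow p dp (suc k) = dp ⊛′ p :^ k ⊕′ p ⊛′ derivePow p dp k

  derive : Polynomial m → Polynomial m
  derive (op [+] p q) = derive p ⊕′ derive q
  derive (op [*] p q) = derive p ⊛′ q ⊕′ p ⊛′ derive q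
  derive (con′ c)     = con′ 0ℚ
  derive (var x)      = δ x
  derive (p :^ k)     = derivePow p (derive p) k
  derive (:- p)       = :- derive p

  derivePoly : List ℚ → Polynomial m → Polynomial m
  derivePoly []       p = con′ 0ℚ
  derivePoly (c ∷ cs) p = con′ c ⊛′ p ⊕′ derivePoly cs (derive p)

  deriveOperator : Fin m → List ℚ → List ℚ → List ℚ → Polynomial m → Polynomial m
  deriveOperator x p₀ p₁ p₂ p = derivePoly p₀ p ⊕′ var x ⊛′ derivePoly p₁ p ⊕′ var x ⊛′ (var x ⊛′ derivePoly p₂ p)

  module _ (ρ : Env m) (θ-var : ∀ x → θ (lookup ρ x) ≗ ⟦ δ x ⟧ ρ) where

    derivePow-sound : ∀ p dp → θ (⟦ p ⟧ ρ) ≗ ⟦ dp ⟧ ρ → ∀ k → θ (⟦ p :^ k ⟧ ρ) ≗ ⟦ derivePow p dp k ⟧ ρ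
    derivePow-sound p dp θp zero    = θ-constant 1ℚ
    derivePow-sound p dp θp (suc k) n = trans (θ-⊛ (⟦ p ⟧ ρ) (⟦ p :^ k ⟧ ρ) n)
      (cong₂ _+_ (⊛-congˡ (⟦ p :^ k ⟧ ρ) θp n) (⊛-congʳ (⟦ p ⟧ ρ) (derivePow-sound p dp θp k) n))

    derive-sound : ∀ p → θ (⟦ p ⟧ ρ) ≗ ⟦ derive p ⟧ ρ
    derive-sound (op [+] p q) n = trans (θ-⊕ (⟦ p ⟧ ρ) (⟦ q ⟧ ρ) n) (cong₂ _+_ (derive-sound p n) (derive-sound q n))
    derive-sound (op [*] p q) n = trans (θ-⊛ (⟦ p ⟧ ρ) (⟦ q ⟧ ρ) n)
      (cong₂ _+_ (⊛-congˡ (⟦ q ⟧ ρ) (derive-sound p) n) (⊛-congʳ (⟦ p ⟧ ρ) (derive-sound q) n))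
    derive-sound (con′ c)     = θ-constant c
    derive-sound (var x)      = θ-var x
    derive-sound (p :^ k)     = derivePow-sound p (derive p) (derive-sound p) k
    derive-sound (:- p) n     = trans (θ-⊖ (⟦ p ⟧ ρ) n) (cong -_ (derive-sound p n))

    derivePoly-sound : ∀ cs p {f} → ⟦ p ⟧ ρ ≗ f → ⟦ derivePoly cs p ⟧ ρ ≗ polyθ cs f
    derivePoly-sound []       p p≗f zero    = refl
    derivePoly-sound []       p p≗f (suc _) = refl
    derivePoly-sound (c ∷ cs) p p≗f n = cong₂ _+_
      (trans (constant-⊛ c (⟦ p ⟧ ρ) n) (cong (c *_) (p≗f n)))
      (derivePoly-sound cs (derive p) (λ k → trans (sym (derive-sound p k)) (θ-cong p≗f k)) n)

    deriveOperator-sound : ∀ x → lookup ρ x ≗ X → ∀ p₀ p₁ p₂ p {f} → ⟦ p ⟧ ρ ≗ f →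
                           ⟦ deriveOperator x p₀ p₁ p₂ p ⟧ ρ ≗ θOperator p₀ p₁ p₂ f
    deriveOperator-sound x x≗X p₀ p₁ p₂ p p≗f n = cong₂ _+_
      (cong₂ _+_ (sound p₀ n) (⊛-cong x≗X (sound p₁) n))
      (⊛-cong x≗X (⊛-cong x≗X (sound p₂)) n)
      where
      sound : ∀ cs → ⟦ derivePoly cs p ⟧ ρ ≗ polyθ cs _
      sound cs = derivePoly-sound cs p p≗f

-- The cube of F

z v φ θφ : Polynomial 4
z  = var 0F
v  = var 1F
φ  = var 2F
θφ = var 3F

F-env : Env 4
F-env = X ∷ geometric ∷ F ∷ θ F ∷ []

F-derivation : Fin 4 → Polynomial 4
F-derivation 0F = z
F-derivation 1F = z ⊛′ (v ⊛′ v)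
F-derivation 2F = θφ
F-derivation 3F = z ⊛′ (v ⊛′ (con′ (ℤ.+ 1 / 2) ⊛′ θφ ⊕′ con′ (ℤ.+ 1 / 18) ⊛′ φ))

θ-F-env : ∀ x → θ (lookup F-env x) ≗ ⟦ F-derivation x ⟧ F-env
θ-F-env 0F = θ-X
θ-F-env 1F = θ-geometric
θ-F-env 2F = λ _ → refl
θ-F-env 3F n = trans (hypergeometric-equation (ℤ.+ 1 / 6) (ℤ.+ 1 / 3) n) (⊛-congʳ X (⊛-congʳ geometric λ k →
  cong₂ _+_ (sym (constant-⊛ (ℤ.+ 1 / 2) (θ F) k)) (sym (constant-⊛ (ℤ.+ 1 / 18) F k))) n)

-- L = θOperator P₀ P₁ P₂, with coefficients in ascending powers of θ.
P₀ P₁ P₂ : List ℚ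
P₀ = 0ℚ ∷ 0ℚ ∷ 0ℚ ∷ 0ℚ ∷ ℕtoℚ 36 ∷ []
P₁ = - ℕtoℚ 6 ∷ - ℕtoℚ 38 ∷ - ℕtoℚ 92 ∷ - ℕtoℚ 108 ∷ - ℕtoℚ 72 ∷ []
P₂ = ℕtoℚ 10 ∷ ℕtoℚ 57 ∷ ℕtoℚ 119 ∷ ℕtoℚ 108 ∷ ℕtoℚ 36 ∷ []

geometric-relation : Polynomial 4
geometric-relation = con′ 1ℚ ⊕′ z ⊛′ v ⊕′ :- v

geometric-relation≗0 : ⟦ geometric-relation ⟧ F-env ≗ 0S
geometric-relation≗0 n = trans (cong (_- 1ℚ) (geometric-unfold n)) (+-inverseʳ 1ℚ)

-- L(φ³) divided by geometric-relation, found by polynomial division outside Agda; the ring solver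
-- checks the product in cube-annihilated.
certificate : Polynomial 4
certificate = con′ (ℤ.+ 1 / 6) ⊛′ z ⊛′
  ( -[ 3888 ] ⊛′ θφ :^ 3 ⊕′ -[ 3312 ] ⊛′ φ ⊛′ θφ :^ 2 ⊕′ -[ 684 ] ⊛′ φ :^ 2 ⊛′ θφ ⊕′ -[ 36 ] ⊛′ φ :^ 3
  ⊕′ z ⊛′ (+[ 3888 ] ⊛′ θφ :^ 3 ⊕′ +[ 4284 ] ⊛′ φ ⊛′ θφ :^ 2 ⊕′ +[ 1026 ] ⊛′ φ :^ 2 ⊛′ θφ ⊕′ +[ 60 ] ⊛′ φ :^ 3)
  ⊕′ z ⊛′ v ⊛′ (-[ 4860 ] ⊛′ φ ⊛′ θφ :^ 2 ⊕′ -[ 2214 ] ⊛′ φ :^ 2 ⊛′ θφ ⊕′ -[ 176 ] ⊛′ φ :^ 3)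
  ⊕′ z :^ 2 ⊛′ v ⊛′ (+[ 4860 ] ⊛′ φ ⊛′ θφ :^ 2 ⊕′ +[ 2457 ] ⊛′ φ :^ 2 ⊛′ θφ ⊕′ +[ 203 ] ⊛′ φ :^ 3)
  ⊕′ z :^ 2 ⊛′ v :^ 2 ⊛′ (-[ 1215 ] ⊛′ φ :^ 2 ⊛′ θφ ⊕′ -[ 135 ] ⊛′ φ :^ 3)
  ⊕′ z :^ 3 ⊛′ v :^ 2 ⊛′ (+[ 1215 ] ⊛′ φ :^ 2 ⊛′ θφ ⊕′ +[ 135 ] ⊛′ φ :^ 3))
  where
  +[_] -[_] : ℕ → Polynomial 4
  +[ k ] = con′ (ℕtoℚ k)
  -[ k ] = con′ (- ℕtoℚ k)

cube-annihilated : θOperator P₀ P₁ P₂ (F ⊛ (F ⊛ F)) ≗ 0S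
cube-annihilated n = begin
  θOperator P₀ P₁ P₂ (F ⊛ (F ⊛ F)) n
    ≡⟨ deriveOperator-sound F-derivation F-env θ-F-env 0F (λ _ → refl) P₀ P₁ P₂ φ³ (λ _ → refl) n ⟨
  ⟦ L[φ³] ⟧ F-env n
    ≡⟨ SeriesSolver.prove F-env L[φ³] (certificate ⊛′ geometric-relation) (λ _ → refl) n ⟩
  (⟦ certificate ⟧ F-env ⊛ ⟦ geometric-relation ⟧ F-env) n
    ≡⟨ ⊛-congʳ (⟦ certificate ⟧ F-env) geometric-relation≗0 n ⟩
  (⟦ certificate ⟧ F-env ⊛ 0S) n
    ≡⟨ trans (⊛-comm (⟦ certificate ⟧ F-env) 0S n) (⊛-zeroˡ (⟦ certificate ⟧ F-env) n) ⟩
  0ℚ ∎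
  where
  open ≡-Reasoning
  φ³ L[φ³] : Polynomial 4
  φ³    = φ ⊛′ (φ ⊛′ φ)
  L[φ³] = deriveOperator F-derivation 0F P₀ P₁ P₂ φ³

cube-recurrence : ∀ n → let N = ℕtoℚ n; Y = F ⊛ (F ⊛ F) in
  evalPoly P₀ (ℕtoℚ 2 + N) * Y (suc (suc n)) + evalPoly P₁ (ℕtoℚ 1 + N) * Y (suc n) + evalPoly P₂ N * Y n ≡ 0ℚ
cube-recurrence n = begin
  evalPoly P₀ (ℕtoℚ 2 + N) * Y (suc (suc n)) + evalPoly P₁ (ℕtoℚ 1 + N) * Y (suc n) + evalPoly P₂ N * Y n
    ≡⟨ cong₂ (λ s₂ s₁ → evalPoly P₀ s₂ * Y (suc (suc n)) + evalPoly P₁ s₁ * Y (suc n) + evalPoly P₂ N * Y n) (ℕtoℚ-+ 2 n) (ℕtoℚ-+ 1 n) ⟨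
  evalPoly P₀ (ℕtoℚ (suc (suc n))) * Y (suc (suc n)) + evalPoly P₁ (ℕtoℚ (suc n)) * Y (suc n) + evalPoly P₂ N * Y n
    ≡⟨ θOperator-coeff P₀ P₁ P₂ Y n ⟨
  θOperator P₀ P₁ P₂ Y (suc (suc n))
    ≡⟨ cube-annihilated (suc (suc n)) ⟩
  0ℚ ∎
  where
  open ≡-Reasoning
  N : ℚ
  N = ℕtoℚ n
  Y : Series
  Y = F ⊛ (F ⊛ F)

horner : ∀ {k} → List ℚ → +-*-Solver.Polynomial k → +-*-Solver.Polynomial k
horner []       x = con 0ℚ
horner (c ∷ cs) x = con c :+ x :* horner cs x

theorem2p1 : ((n : ℕ) →
    let N = ℕtoℚ n in
    (N + ℕtoℚ 2) * (N + ℕtoℚ 2) * (N + ℕtoℚ 2) * (N + ℕtoℚ 2) * A (suc (suc n))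
    - ℕtoℚ 6 * (ℕtoℚ 36 * N * N * N * N + ℕtoℚ 198 * N * N * N + ℕtoℚ 424 * N * N + ℕtoℚ 417 * N + ℕtoℚ 158) * A (suc n)
    + ℕtoℚ 324 * (N + ℕtoℚ 1) * (ℕtoℚ 2 * N + ℕtoℚ 1) * (ℕtoℚ 3 * N + ℕtoℚ 2) * (ℕtoℚ 6 * N + ℕtoℚ 5) * A n
    ≡ 0ℚ)
    × A 0 ≡ ℕtoℚ 1 × A 1 ≡ ℕtoℚ 18 × A 2 ≡ ℕtoℚ 864
theorem2p1 = (λ n →
  let open ≡-Reasoning
      N : ℚ
      N = ℕtoℚ n
      Xⁿ : ℚ
      Xⁿ = ℕtoℚ 108 ^ℚ n
      Y : Series
      Y = F ⊛ (F ⊛ F)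
      c : ℕ → +-*-Solver.Polynomial 5
      c k = con (ℕtoℚ k)
  in begin
  _ ≡⟨ solve 5 (λ t x y₀ y₁ y₂ →
         (t :+ c 2) :* (t :+ c 2) :* (t :+ c 2) :* (t :+ c 2) :* (c 108 :* (c 108 :* x) :* y₂)
         :- c 6 :* (c 36 :* t :* t :* t :* t :+ c 198 :* t :* t :* t :+ c 424 :* t :* t :+ c 417 :* t :+ c 158) :* (c 108 :* x :* y₁)
         :+ c 324 :* (t :+ c 1) :* (c 2 :* t :+ c 1) :* (c 3 :* t :+ c 2) :* (c 6 :* t :+ c 5) :* (x :* y₀)
         := c 324 :* x :* (horner P₀ (c 2 :+ t) :* y₂ :+ horner P₁ (c 1 :+ t) :* y₁ :+ horner P₂ t :* y₀))
       refl N Xⁿ (Y n) (Y (suc n)) (Y (suc (suc n))) ⟩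
  ℕtoℚ 324 * Xⁿ * (evalPoly P₀ (ℕtoℚ 2 + N) * Y (suc (suc n)) + evalPoly P₁ (ℕtoℚ 1 + N) * Y (suc n) + evalPoly P₂ N * Y n)
    ≡⟨ cong (ℕtoℚ 324 * Xⁿ *_) (cube-recurrence n) ⟩
  ℕtoℚ 324 * Xⁿ * 0ℚ
    ≡⟨ *-zeroʳ (ℕtoℚ 324 * Xⁿ) ⟩
  0ℚ ∎) , refl , refl , refl
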